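{- Let $r$ be a positive integer and $q\ge 3$ an integer. Let $G\in H_v(2_r;q)$ with $|V(G)|=F_v(2_r;q)$. Then (a) $G$ is a vertex-critical $(r+1)$-chromatic graph, i.e. $\chi(G)=r+1$ and $\chi(G-v)<\chi(G)$ for every $v\in V(G)$; (b) if $q<r+3$, then $\omega(G)=q-1$.
   Context: All graphs are finite, undirected, without loops or multiple edges. $\omega(G)$ is the clique number of $G$; $G-v$ is the subgraph induced by $V(G)\setminus\{v\}$. $G\to^v(2_r)$ means that every partition of $V(G)$ into $r$ pairwise disjoint (possibly empty) classes has a class containing an edge, i.e. $\chi(G)\ge r+1$. $H_v(2_r;q)$ is the set of graphs $G$ with $G\to^v(2_r)$ and $\omega(G)<q$, and $F_v(2_r;q)=\min\{|V(G)|:G\in H_v(2_r;q)\}$. -}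

module Defs where

open import Data.Nat using (ℕ; zero; suc; pred; _<_; _∸_)
open import Data.Fin using (Fin; punchIn)
open import Data.Bool using (Bool; true; false)
open import Data.Product using (Σ; ∃; _×_; _,_)
open import Relation.Binary.PropositionalEquality using (_≡_; _≢_)
open import Relation.Nullary using (¬_)
open import Function.Definitions using (Injective)

record Graph (n : ℕ) : Set where
  field
    adj    : Fin n → Fin n → Bool
    sym    : ∀ u v → adj u v ≡ adj v u
    irrefl : ∀ v → adj v v ≡ false
open Graph public

deleteVertex : ∀ {n} → Graph n → Fin n → Graph (pred n)
deleteVertex {suc m} G v = record
  { adj    = λ x y → adj G (punchIn v x) (punchIn v y)
  ; sym    = λ x y → sym G (punchIn v x) (punchIn v y)
  ; irrefl = λ x → irrefl G (punchIn v x) }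

HasClique : ∀ {n} → Graph n → ℕ → Set
HasClique {n} G k =
  Σ (Fin k → Fin n) λ f → Injective _≡_ _≡_ f × (∀ i j → i ≢ j → adj G (f i) (f j) ≡ true)

CliqueNumberLT : ∀ {n} → Graph n → ℕ → Set
CliqueNumberLT G q = ∀ k → HasClique G k → k < q

IsCliqueNumber : ∀ {n} → Graph n → ℕ → Set
IsCliqueNumber G k = HasClique G k × (∀ j → HasClique G j → ¬ (k < j))

Colorable : ∀ {n} → Graph n → ℕ → Set
Colorable {n} G k = Σ (Fin n → Fin k) λ c → ∀ u v → adj G u v ≡ true → c u ≢ c v

IsChromaticNumber : ∀ {n} → Graph n → ℕ → Set
IsChromaticNumber G k = Colorable G k × (∀ j → j < k → ¬ Colorable G j)

-- G →^v (2_r): every partition of V(G) into r classes has a class containing an edge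
VArrow : ∀ {n} → Graph n → ℕ → Set
VArrow {n} G r = (c : Fin n → Fin r) → ∃ λ u → ∃ λ v → adj G u v ≡ true × c u ≡ c v

InH : ∀ {n} → Graph n → ℕ → ℕ → Set
InH G r q = VArrow G r × CliqueNumberLT G q

-- |V(G)| = F_v(2_r; q), given G ∈ H_v(2_r;q): no graph in H_v(2_r;q) has fewer vertices
IsMinimalOrder : ℕ → ℕ → ℕ → Set
IsMinimalOrder n r q = ∀ m (H : Graph m) → InH H r q → ¬ (m < n)

module Submission where

-- Everything is finite, so existence of a colouring or of a clique is decided
-- by exhaustive search over maps between finite sets.  With that in hand:
--   * G →v (2_r) says exactly that G is not r-colourable, and a chromatic
--     number exists below any number of colours that suffices.
--   * (a) Deleting a vertex keeps ω < q, so by minimality every G - v is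
--     r-colourable.  An r-colouring of G - 0 extends to G with one new colour,
--     giving χ(G) = r + 1 and χ(G - v) ≤ r.
--   * (b) If G is complete it has n ≥ χ(G) = r + 1 ≥ q - 1 vertices.  Otherwise
--     identify two nonadjacent vertices u, v: the quotient graph has one vertex
--     less, still arrows (2_r) (colourings pull back), and each clique of size
--     k + 1 in it yields a clique of size k in G.  If G had no (q-1)-clique the
--     quotient would lie in H_v(2_r;q), contradicting minimality.

open import Defs
open import Data.Nat using (ℕ; suc; _<_; _≤_; _+_; _∸_)
open import Data.Fin using (Fin)
open import Data.Product using (Σ; ∃; _×_)

open import Data.Nat using (zero; z≤n; s≤s; _≤?_)
open import Data.Nat.Properties
  using (≤-refl; ≤-trans; ≤-pred; m≤n⇒m≤1+n; ≰⇒>; ≮⇒≥; ≤⇒≯; n<1+n; +-comm; ∸-monoˡ-≤)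
open import Data.Fin using (zero; suc; punchIn; punchOut; inject≤; inject₁; fromℕ)
open import Data.Fin.Properties
  using (_≟_; any?; all?; inject≤-injective; punchIn-injective; punchInᵢ≢i; punchIn-punchOut;
         fromℕ≢inject₁; inject₁-injective)
open import Data.Vec.Functional using ([]; _∷_; head; tail)
open import Data.Bool using (true; false)
open import Data.Bool.Properties using (¬-not) renaming (_≟_ to _≟ᵇ_)
open import Data.Product using (_,_; proj₁; proj₂)
open import Data.Sum using (_⊎_; inj₁; inj₂)
open import Function using (id; _∘_)
open import Function.Bundles using (mk⇔)
open import Function.Definitions using (Injective)
open import Relation.Nullary using (¬_; Dec; yes; no; contradiction; contraposition)
open import Relation.Nullary.Decidable
  using (does; map′; _×-dec_; _→-dec_; ¬?; decidable-stable; does-⇔; dec-true; dec-false)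
open import Relation.Unary using (Decidable)
open import Relation.Binary.PropositionalEquality
  using (_≡_; _≢_; refl; trans; cong; subst; subst₂; module ≡-Reasoning) renaming (sym to ≡-sym)

Extensional : ∀ {n k} → ((Fin n → Fin k) → Set) → Set
Extensional P = ∀ {f g} → (∀ x → f x ≡ g x) → P f → P g

searchMaps : ∀ n {k} (P : (Fin n → Fin k) → Set) → Extensional P → Decidable P → Dec (∃ P)
searchMaps zero P ext P? = map′ (λ p → [] , p) (λ (f , p) → ext (λ ()) p) (P? [])
searchMaps (suc n) P ext P? =
  map′ (λ (a , g , p) → a ∷ g , p)
       (λ (f , p) → head f , tail f , ext (λ { zero → refl ; (suc x) → refl }) p)
       (any? λ a → searchMaps n (P ∘ (a ∷_))
                     (λ e → ext λ { zero → refl ; (suc x) → e x }) (P? ∘ (a ∷_)))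

Proper : ∀ {n k} → Graph n → (Fin n → Fin k) → Set
Proper G c = ∀ u v → adj G u v ≡ true → c u ≢ c v

colorable? : ∀ {n} (G : Graph n) k → Dec (Colorable G k)
colorable? {n} G k = searchMaps n (Proper G)
  (λ e proper u v uv eq → proper u v uv (trans (e u) (trans eq (≡-sym (e v)))))
  (λ c → all? λ u → all? λ v → (adj G u v ≟ᵇ true) →-dec ¬? (c u ≟ c v))

colorable-mono : ∀ {n} (G : Graph n) {j k} → j ≤ k → Colorable G j → Colorable G k
colorable-mono G j≤k (c , proper) =
  (λ x → inject≤ (c x) j≤k) , λ u v uv eq → proper u v uv (inject≤-injective _ _ _ _ eq)

-- G →v (2_r) is the failure of r-colourability; the converse direction needs
-- the decidability of both colourability and of having a monochromatic edge.
arrow⇒¬colorable : ∀ {n} (G : Graph n) {r} → VArrow G r → ¬ Colorable G r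
arrow⇒¬colorable G arrow (c , proper) =
  let (u , v , uv , eq) = arrow c in proper u v uv eq

¬colorable⇒arrow : ∀ {n} (G : Graph n) {r} → ¬ Colorable G r → VArrow G r
¬colorable⇒arrow G ¬col c =
  decidable-stable (any? λ u → any? λ v → (adj G u v ≟ᵇ true) ×-dec (c u ≟ c v))
    λ noMonochromaticEdge → ¬col (c , λ u v uv eq → noMonochromaticEdge (u , v , uv , eq))

¬arrow⇒colorable : ∀ {n} (G : Graph n) r → ¬ VArrow G r → Colorable G r
¬arrow⇒colorable G r = decidable-stable (colorable? G r) ∘ contraposition (¬colorable⇒arrow G)

chromaticNumber-≤ : ∀ {n} (G : Graph n) k → Colorable G k → ∃ λ j → IsChromaticNumber G j × j ≤ k
chromaticNumber-≤ G zero col = zero , (col , λ _ ()) , z≤n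
chromaticNumber-≤ G (suc k) col with colorable? G k
... | yes colₖ = let (j , χ , j≤k) = chromaticNumber-≤ G k colₖ in j , χ , m≤n⇒m≤1+n j≤k
... | no ¬colₖ = suc k , (col , λ j j≤k col′ → ¬colₖ (colorable-mono G (≤-pred j≤k) col′)) , ≤-refl

extendColoring : ∀ {m k} (G : Graph (suc m)) → Colorable (deleteVertex G zero) k → Colorable G (suc k)
extendColoring {k = k} G (c , proper) = c′ , proper′
  where
  c′ : Fin _ → Fin (suc k)
  c′ zero    = fromℕ k
  c′ (suc x) = inject₁ (c x)

  proper′ : Proper G c′
  proper′ zero    zero    uv _  = contradiction (trans (≡-sym (irrefl G zero)) uv) λ ()
  proper′ zero    (suc v) _  eq = fromℕ≢inject₁ eq
  proper′ (suc u) zero    _  eq = fromℕ≢inject₁ (≡-sym eq)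
  proper′ (suc u) (suc v) uv eq = proper u v uv (inject₁-injective eq)

identityColoring : ∀ {n} (G : Graph n) → Colorable G n
identityColoring G = id , λ { u .u uv refl → contradiction (trans (≡-sym (irrefl G u)) uv) λ () }

IsClique : ∀ {n k} → Graph n → (Fin k → Fin n) → Set
IsClique G f = Injective _≡_ _≡_ f × (∀ i j → i ≢ j → adj G (f i) (f j) ≡ true)

hasClique? : ∀ {n} (G : Graph n) k → Dec (HasClique G k)
hasClique? G k = searchMaps k (IsClique G)
  (λ e (inj , clq) → (λ eq → inj (trans (e _) (trans eq (≡-sym (e _))))) ,
                     λ i j i≢j → subst₂ (λ a b → adj G a b ≡ true) (e i) (e j) (clq i j i≢j))
  (λ f → injective? f ×-dec (all? λ i → all? λ j → ¬? (i ≟ j) →-dec (adj G (f i) (f j) ≟ᵇ true)))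
  where
  injective? : ∀ {n k} (f : Fin k → Fin n) → Dec (Injective _≡_ _≡_ f)
  injective? f = map′ (λ inj {i} {j} → inj i j) (λ inj _ _ → inj)
                      (all? λ i → all? λ j → (f i ≟ f j) →-dec (i ≟ j))

clique-mono : ∀ {n} (G : Graph n) {j k} → j ≤ k → HasClique G k → HasClique G j
clique-mono G j≤k (f , inj , clq) =
  (λ i → f (inject≤ i j≤k)) , (inject≤-injective _ _ _ _ ∘ inj) ,
  λ i i′ i≢i′ → clq _ _ (i≢i′ ∘ inject≤-injective _ _ _ _)

noClique⇒smaller : ∀ {n} (G : Graph n) {j k} → ¬ HasClique G j → HasClique G k → k < j
noClique⇒smaller G {j} {k} ¬K K with j ≤? k
... | yes j≤k = contradiction (clique-mono G j≤k K) ¬K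
... | no j≰k = ≰⇒> j≰k

-- A clique of G - v is a clique of G, so deleting a vertex keeps ω < q.
deleteVertex-cliqueBound : ∀ {m q} (G : Graph (suc m)) v →
  CliqueNumberLT G q → CliqueNumberLT (deleteVertex G v) q
deleteVertex-cliqueBound G v bound k (f , inj , clq) =
  bound k (punchIn v ∘ f , inj ∘ punchIn-injective v _ _ , clq)

complete-clique : ∀ {n} (G : Graph n) → (∀ u v → u ≢ v → adj G u v ≡ true) → HasClique G n
complete-clique G complete = id , id , complete

complete-or-nonadjacent : ∀ {n} (G : Graph n) →
  (∀ u v → u ≢ v → adj G u v ≡ true) ⊎ (∃ λ u → ∃ λ v → u ≢ v × adj G u v ≡ false)
complete-or-nonadjacent G
  with any? (λ u → any? λ v → ¬? (u ≟ v) ×-dec (adj G u v ≟ᵇ false))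
... | yes nonadjacent = inj₂ nonadjacent
... | no none = inj₁ λ u v u≢v → ¬-not λ uv → none (u , v , u≢v , uv)

avoidVertex : ∀ {n k} (f : Fin (suc k) → Fin n) → Injective _≡_ _≡_ f → ∀ t →
  ∃ λ i → ∀ j → f (punchIn i j) ≢ t
avoidVertex f inj t with any? (λ i → f i ≟ t)
... | yes (i , fi≡t) = i , λ j eq → punchInᵢ≢i i j (inj (trans eq (≡-sym fi≡t)))
... | no ¬hit = zero , λ j eq → ¬hit (_ , eq)

module Quotient {n m} (G : Graph n) (φ : Fin n → Fin m)
                (fibresIndependent : ∀ a b → φ a ≡ φ b → adj G a b ≡ false) where

  Joined : Fin m → Fin m → Set
  Joined x y = ∃ λ a → ∃ λ b → φ a ≡ x × φ b ≡ y × adj G a b ≡ true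

  joined? : ∀ x y → Dec (Joined x y)
  joined? x y = any? λ a → any? λ b → (φ a ≟ x) ×-dec (φ b ≟ y) ×-dec (adj G a b ≟ᵇ true)

  joined-sym : ∀ {x y} → Joined x y → Joined y x
  joined-sym (a , b , φa , φb , ab) = b , a , φb , φa , trans (Graph.sym G b a) ab

  quotient : Graph m
  quotient = record
    { adj    = λ x y → does (joined? x y)
    ; sym    = λ x y → does-⇔ (mk⇔ joined-sym joined-sym) (joined? x y) (joined? y x)
    ; irrefl = λ x → dec-false (joined? x x) λ (a , b , φa , φb , ab) →
        contradiction (trans (≡-sym (fibresIndependent a b (trans φa (≡-sym φb)))) ab) λ () }

  quotient-edge : ∀ x y → adj quotient x y ≡ true → Joined x y
  quotient-edge x y with joined? x y
  ... | yes joined = λ _ → joined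
  ... | no _ = λ ()

  -- A colouring of the quotient pulls back along φ, and a monochromatic edge of G
  -- maps to a monochromatic edge of the quotient.
  quotient-arrow : ∀ {r} → VArrow G r → VArrow quotient r
  quotient-arrow arrow c =
    let (a , b , ab , eq) = arrow (c ∘ φ)
    in φ a , φ b , dec-true (joined? (φ a) (φ b)) (a , b , refl , refl , ab) , eq

-- Identifying two nonadjacent vertices u ≠ v: u is redirected to v, and the
-- n - 1 remaining vertices are renumbered by punching out u.
module Merge {m} (G : Graph (suc m)) {u v} (u≢v : u ≢ v) (uv : adj G u v ≡ false) where

  redirect : Fin (suc m) → Fin (suc m)
  redirect a with u ≟ a
  ... | yes _ = v
  ... | no _  = a

  redirect-spec : ∀ a → (a ≡ u × redirect a ≡ v) ⊎ (a ≢ u × redirect a ≡ a)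
  redirect-spec a with u ≟ a
  ... | yes u≡a = inj₁ (≡-sym u≡a , refl)
  ... | no u≢a  = inj₂ (u≢a ∘ ≡-sym , refl)

  redirect-u : redirect u ≡ v
  redirect-u with u ≟ u
  ... | yes _  = refl
  ... | no u≢u = contradiction refl u≢u

  redirect-v : redirect v ≡ v
  redirect-v with u ≟ v
  ... | yes u≡v = contradiction u≡v u≢v
  ... | no _    = refl

  redirect≢u : ∀ a → u ≢ redirect a
  redirect≢u a with redirect-spec a
  ... | inj₁ (_ , ra)   = λ eq → u≢v (trans eq ra)
  ... | inj₂ (a≢u , ra) = λ eq → a≢u (≡-sym (trans eq ra))

  merge : Fin (suc m) → Fin m
  merge a = punchOut (redirect≢u a)

  punchIn-merge : ∀ a → punchIn u (merge a) ≡ redirect a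
  punchIn-merge a = punchIn-punchOut (redirect≢u a)

  merged : merge u ≡ merge v
  merged = punchIn-injective u _ _ (begin
    punchIn u (merge u) ≡⟨ punchIn-merge u ⟩
    redirect u          ≡⟨ redirect-u ⟩
    v                   ≡⟨ ≡-sym redirect-v ⟩
    redirect v          ≡⟨ ≡-sym (punchIn-merge v) ⟩
    punchIn u (merge v) ∎)
    where open ≡-Reasoning

  -- Vertices with the same image are equal or are the nonadjacent pair {u, v}.
  merge-independent : ∀ a b → merge a ≡ merge b → adj G a b ≡ false
  merge-independent a b eq = independent a b (begin
    redirect a          ≡⟨ ≡-sym (punchIn-merge a) ⟩
    punchIn u (merge a) ≡⟨ cong (punchIn u) eq ⟩
    punchIn u (merge b) ≡⟨ punchIn-merge b ⟩
    redirect b          ∎)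
    where
    open ≡-Reasoning
    independent : ∀ a b → redirect a ≡ redirect b → adj G a b ≡ false
    independent a b same with redirect-spec a | redirect-spec b
    ... | inj₁ (refl , _)  | inj₁ (refl , _)  = irrefl G u
    ... | inj₁ (refl , ra) | inj₂ (_ , rb)    =
      subst (λ z → adj G u z ≡ false) (trans (≡-sym ra) (trans same rb)) uv
    ... | inj₂ (_ , ra)    | inj₁ (refl , rb) =
      subst (λ z → adj G z u ≡ false) (trans (≡-sym rb) (trans (≡-sym same) ra))
            (trans (Graph.sym G v u) uv)
    ... | inj₂ (_ , ra)    | inj₂ (_ , rb)    =
      subst (λ z → adj G a z ≡ false) (trans (≡-sym ra) (trans same rb)) (irrefl G a)

  open Quotient G merge merge-independent public

  merge-fibre : ∀ {a x} → merge a ≡ x → x ≢ merge v → a ≡ punchIn u x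
  merge-fibre {a} refl a≁v with redirect-spec a
  ... | inj₁ (refl , _) = contradiction merged a≁v
  ... | inj₂ (_ , ra)   = trans (≡-sym ra) (≡-sym (punchIn-merge a))

  -- A (k+1)-clique of the quotient minus its (possible) merged class lifts to a k-clique of G.
  merge-clique : ∀ {k} → HasClique quotient (suc k) → HasClique G k
  merge-clique {k} (f , inj , clq) = g , g-injective , g-clique
    where
    i₀ : Fin (suc k)
    i₀ = proj₁ (avoidVertex f inj (merge v))

    avoids : ∀ j → f (punchIn i₀ j) ≢ merge v
    avoids = proj₂ (avoidVertex f inj (merge v))

    g : Fin k → Fin (suc m)
    g j = punchIn u (f (punchIn i₀ j))

    g-injective : Injective _≡_ _≡_ g
    g-injective = punchIn-injective i₀ _ _ ∘ inj ∘ punchIn-injective u _ _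

    g-clique : ∀ i j → i ≢ j → adj G (g i) (g j) ≡ true
    g-clique i j i≢j =
      let (a , b , ma , mb , ab) = quotient-edge _ _ (clq _ _ (i≢j ∘ punchIn-injective i₀ _ _))
      in subst₂ (λ a b → adj G a b ≡ true) (merge-fibre ma (avoids i)) (merge-fibre mb (avoids j)) ab

m<n∸1⇒1+m<n : ∀ {m n} → m < n ∸ 1 → suc m < n
m<n∸1⇒1+m<n {n = suc n} m<n = s≤s m<n

module MinimalGraph {r q m} (G : Graph (suc m)) (inH : InH G r q)
                    (minimal : IsMinimalOrder (suc m) r q) where

  arrow : VArrow G r
  arrow = proj₁ inH

  cliqueBound : CliqueNumberLT G q
  cliqueBound = proj₂ inH

  -- G - w keeps ω < q but has too few vertices to arrow (2_r), so it is r-colourable.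
  deleteVertex-colorable : ∀ w → Colorable (deleteVertex G w) r
  deleteVertex-colorable w = ¬arrow⇒colorable (deleteVertex G w) r λ arrow′ →
    minimal m (deleteVertex G w) (arrow′ , deleteVertex-cliqueBound G w cliqueBound) (n<1+n m)

  chromatic : IsChromaticNumber G (suc r)
  chromatic = extendColoring G (deleteVertex-colorable zero) ,
              λ j j<1+r col → arrow⇒¬colorable G arrow (colorable-mono G (≤-pred j<1+r) col)

  critical : ∀ w → ∃ λ k → IsChromaticNumber (deleteVertex G w) k × k < suc r
  critical w =
    let (k , χ , k≤r) = chromaticNumber-≤ (deleteVertex G w) r (deleteVertex-colorable w)
    in k , χ , s≤s k≤r

  -- Merging nonadjacent u, v gives a smaller graph that still arrows (2_r); by
  -- minimality it has a q-clique, hence G has a (q-1)-clique.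
  nonadjacent⇒clique : 0 < q → ∀ {u v} → u ≢ v → adj G u v ≡ false → HasClique G (q ∸ 1)
  nonadjacent⇒clique 0<q u≢v uv = decidable-stable (hasClique? G (q ∸ 1)) λ ¬K →
    minimal m quotient (quotient-arrow arrow , quotientBound ¬K) (n<1+n m)
    where
    open Merge G u≢v uv
    quotientBound : ¬ HasClique G (q ∸ 1) → CliqueNumberLT quotient q
    quotientBound ¬K zero    _ = 0<q
    quotientBound ¬K (suc k) K = m<n∸1⇒1+m<n (noClique⇒smaller G ¬K (merge-clique K))

  -- A complete G is a clique on n ≥ χ(G) = r + 1 ≥ q - 1 vertices.
  complete⇒clique : q < r + 3 → (∀ u v → u ≢ v → adj G u v ≡ true) → HasClique G (q ∸ 1)
  complete⇒clique q<r+3 complete = clique-mono G (≤-trans q∸1≤1+r 1+r≤n) (complete-clique G complete)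
    where
    q∸1≤1+r : q ∸ 1 ≤ suc r
    q∸1≤1+r = ∸-monoˡ-≤ 1 (≤-pred (subst (suc q ≤_) (+-comm r 3) q<r+3))
    1+r≤n : suc r ≤ suc m
    1+r≤n = ≮⇒≥ λ n<1+r → proj₂ chromatic (suc m) n<1+r (identityColoring G)

  cliqueNumber : 0 < q → q < r + 3 → IsCliqueNumber G (q ∸ 1)
  cliqueNumber 0<q q<r+3 = clique , λ j K → ≤⇒≯ (∸-monoˡ-≤ 1 (cliqueBound j K))
    where
    clique : HasClique G (q ∸ 1)
    clique with complete-or-nonadjacent G
    ... | inj₁ complete               = complete⇒clique q<r+3 complete
    ... | inj₂ (u , v , u≢v , uv) = nonadjacent⇒clique 0<q u≢v uv

-- The theorem.  The empty graph arrows nothing; otherwise G has vertices to delete.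
lemma2p2 : (r q : ℕ) → 1 ≤ r → 3 ≤ q → (n : ℕ) (G : Graph n) →
    InH G r q → IsMinimalOrder n r q →
    (IsChromaticNumber G (suc r) ×
      (∀ (v : Fin n) → ∃ λ k → IsChromaticNumber (deleteVertex G v) k × k < suc r))
    × (q < r + 3 → IsCliqueNumber G (q ∸ 1))
lemma2p2 r q _ 3≤q zero G (arrow , _) _ with arrow (λ ())
... | () , _
lemma2p2 r q _ 3≤q (suc m) G inH minimal = (chromatic , critical) , cliqueNumber 0<q
  where
  open MinimalGraph G inH minimal
  0<q : 0 < q
  0<q = ≤-trans (s≤s z≤n) 3≤q
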